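{- Let $k,p,m\in\mathbb{N}$, let $M_1,\dots,M_k\in\mathbb{Q}^{p\times\aleph_0}$ be skeletal matrices, and let $H$ be an $m\times p$ tie matrix. Then there exists a stochastic finitely supported vector $v\in\mathbb{Q}^{\aleph_0}$ with $v_1>0$ such that $M_jv$ is $H$-tieless for every $j\in[k]$.
   Context: Matrices in $\mathbb{Q}^{p\times\aleph_0}$ have rows indexed by $[p]$ and columns indexed by $\mathbb{N}$; vectors in $\mathbb{Q}^{\aleph_0}$ are indexed by $\mathbb{N}$; $v$ is finitely supported if only finitely many entries are nonzero, and stochastic if its entries are nonnegative and sum to $1$ (so $M_jv$ is a well-defined vector in $\mathbb{Q}^p$). A matrix $M\in\mathbb{Q}^{p\times\aleph_0}$ is skeletal if for every $j\in[p]$ either the $j$-th row of $M$ is zero or some column of $M$ equals the $j$-th standard unit vector $e_j$. A vector $w\in\mathbb{R}^p$ is tieless if for all $i\ne i'$, $w_i\ne0$ implies $w_i\ne w_{i'}$. A tie matrix is a matrix with nonnegative integer entries each of whose columns is tieless; for an $m\times p$ tie matrix $H$, $u\in\mathbb{R}^p$ is $H$-tieless if $Hu$ is tieless. -}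

module Defs where

open import Data.Nat using (ℕ; zero; suc; _≥_)
open import Data.Integer using (+_)
open import Data.Fin using (Fin; _≟_)
open import Data.Rational using (ℚ; 0ℚ; 1ℚ; _+_; _*_; _≤_; _<_) renaming (_/_ to _÷_)
open import Data.Product using (Σ; ∃; _×_)
open import Data.Sum using (_⊎_)
open import Relation.Nullary using (¬_; yes; no)
open import Relation.Binary.PropositionalEquality using (_≡_; _≢_)

ℕ→ℚ : ℕ → ℚ
ℕ→ℚ n = + n ÷ 1

Mat∞ : ℕ → Set
Mat∞ p = Fin p → ℕ → ℚ

Vec∞ : Set
Vec∞ = ℕ → ℚ

sumTo : ℕ → (ℕ → ℚ) → ℚ
sumTo zero    f = 0ℚ
sumTo (suc N) f = sumTo N f + f N

sumFin : (p : ℕ) → (Fin p → ℚ) → ℚ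
sumFin zero    f = 0ℚ
sumFin (suc p) f = f Fin.zero + sumFin p (λ i → f (Fin.suc i))

SupportedBelow : ℕ → Vec∞ → Set
SupportedBelow N v = ∀ n → n ≥ N → v n ≡ 0ℚ

FinitelySupported : Vec∞ → Set
FinitelySupported v = ∃ λ N → SupportedBelow N v

-- nonnegative entries summing to 1 (the sum is over a finite support bound N)
Stochastic : (N : ℕ) → Vec∞ → Set
Stochastic N v = (∀ n → 0ℚ ≤ v n) × sumTo N v ≡ 1ℚ

-- M v, computed as a finite sum over a support bound N of v
mulVec∞ : ∀ {p} → Mat∞ p → (N : ℕ) → Vec∞ → Fin p → ℚ
mulVec∞ M N v i = sumTo N (λ n → M i n * v n)

unitVec : ∀ {p} → Fin p → Fin p → ℚ
unitVec j i with i ≟ j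
... | yes _ = 1ℚ
... | no  _ = 0ℚ

Skeletal : ∀ {p} → Mat∞ p → Set
Skeletal {p} M = ∀ (j : Fin p) →
  (∀ n → M j n ≡ 0ℚ) ⊎ (∃ λ n → ∀ i → M i n ≡ unitVec j i)

Tieless : ∀ {p} → (Fin p → ℚ) → Set
Tieless {p} w = ∀ (i i' : Fin p) → i ≢ i' → w i ≢ 0ℚ → w i ≢ w i'

TieMatrix : (m p : ℕ) → (Fin m → Fin p → ℕ) → Set
TieMatrix m p H = ∀ (c : Fin p) → Tieless (λ r → ℕ→ℚ (H r c))

mulTie : ∀ {m p} → (Fin m → Fin p → ℕ) → (Fin p → ℚ) → Fin m → ℚ
mulTie {m} {p} H u r = sumFin p (λ c → ℕ→ℚ (H r c) * u c)

HTieless : ∀ {m p} → (Fin m → Fin p → ℕ) → (Fin p → ℚ) → Set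
HTieless H u = Tieless (mulTie H u)

{-# OPTIONS --safe #-}
module Submission where

-- Start from the point mass at column 1 and enforce the finitely many
-- requirements, one pair of rows r ≢ r' of H M_j at a time. If row r of H M_j is
-- not identically zero, some c has H r c ≢ 0 while M_j has the unit column e_c at
-- some index n; at the point mass at n the gap between rows r and r' is
-- H r c - H r' c ≢ 0, because column c of H is tieless. Mixing the current vector
-- with that point mass with weight e turns every gap into an affine function of e
-- that is not identically zero, so all but finitely many e ∈ (0,1) keep the
-- earlier gaps nonzero and make the new one nonzero.

open import Defs
open import Data.Nat as ℕ using (ℕ; zero; suc; _⊔_; s≤s)
import Data.Nat.Properties as ℕ
open import Data.Fin as Fin using (Fin)
open import Data.Fin.Properties using (∀-cons; ∃-there; suc-injective)
open import Data.Rational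
  using (ℚ; 0ℚ; 1ℚ; ½; _+_; _*_; _-_; -_; 1/_; _≤_; _<_; _⊓_; NonZero; ≢-nonZero; positive; nonNegative)
open import Data.Rational.Properties
  using ( _≟_; _≤?_; _<?_; ≤-refl; ≤-trans; <⇒≤; <-≤-trans; ≰⇒>; <-irrefl
        ; +-identityˡ; +-identityʳ; +-inverseʳ; +-mono-≤; +-mono-<-≤; +-monoˡ-≤; +-monoˡ-<
        ; *-identityˡ; *-identityʳ; *-zeroˡ; *-zeroʳ; *-assoc; *-inverseʳ; *-monoˡ-<-pos
        ; nonNeg*nonNeg⇒nonNeg; pos*pos⇒pos; nonNegative⁻¹; positive⁻¹
        ; +-0-group; ⊓-sel; p⊓q≤p; p⊓q≤q; p≤q⇒p⊓r≤q )
open import Data.Rational.Solver using (module +-*-Solver)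
open +-*-Solver using (solve; _:=_; con; _:+_; _:*_; _:-_)
open import Algebra.Properties.Group +-0-group using (x∙y⁻¹≈ε⇒x≈y)
open import Data.Product using (Σ; ∃; _×_; _,_; proj₁; proj₂)
open import Data.Sum as Sum using (_⊎_; inj₁; inj₂; [_,_]′)
open import Data.Unit using (tt)
open import Data.List using (List; []; _∷_; map; allFin; cartesianProduct)
open import Data.List.Relation.Unary.All as All using (All; []; _∷_)
open import Data.List.Relation.Unary.All.Properties using (map⁻)
open import Data.List.Membership.Propositional using (_∈_)
open import Data.List.Membership.Propositional.Properties using (∈-cartesianProduct⁺; ∈-allFin)
open import Function using (_∘_; id)
open import Relation.Nullary using (yes; no; contradiction)
open import Relation.Nullary.Decidable using (toWitness)
open import Relation.Binary.PropositionalEquality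
  using (_≡_; _≢_; refl; sym; trans; cong; cong₂; subst; module ≡-Reasoning)

0<1 : 0ℚ < 1ℚ
0<1 = toWitness {a? = 0ℚ <? 1ℚ} tt

0≤1-e : ∀ {e} → e ≤ 1ℚ → 0ℚ ≤ 1ℚ - e
0≤1-e {e} e≤1 = subst (_≤ 1ℚ - e) (+-inverseʳ e) (+-monoˡ-≤ (- e) e≤1)

0<1-e : ∀ {e} → e < 1ℚ → 0ℚ < 1ℚ - e
0<1-e {e} e<1 = subst (_< 1ℚ - e) (+-inverseʳ e) (+-monoˡ-< (- e) e<1)

0≤* : ∀ {x y} → 0ℚ ≤ x → 0ℚ ≤ y → 0ℚ ≤ x * y
0≤* {x} {y} 0≤x 0≤y =
  nonNegative⁻¹ _ {{nonNeg*nonNeg⇒nonNeg x {{nonNegative 0≤x}} y {{nonNegative 0≤y}}}}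

0<* : ∀ {x y} → 0ℚ < x → 0ℚ < y → 0ℚ < x * y
0<* {x} {y} 0<x 0<y = positive⁻¹ _ {{pos*pos⇒pos x {{positive 0<x}} y {{positive 0<y}}}}

-- Opaque, so that unification never unfolds a mixture into rational arithmetic.
opaque
  mix : ℚ → ℚ → ℚ → ℚ
  mix e a b = (1ℚ - e) * a + e * b

  mix-same : ∀ e a → mix e a a ≡ a
  mix-same = solve 2 (λ e a → (con 1ℚ :- e) :* a :+ e :* a := a) refl

  mix-+ : ∀ e a b c d → mix e a b + mix e c d ≡ mix e (a + c) (b + d)
  mix-+ = solve 5 (λ e a b c d →
    ((con 1ℚ :- e) :* a :+ e :* b) :+ ((con 1ℚ :- e) :* c :+ e :* d)
      := (con 1ℚ :- e) :* (a :+ c) :+ e :* (b :+ d)) refl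

  mix-- : ∀ e a b c d → mix e a b - mix e c d ≡ mix e (a - c) (b - d)
  mix-- = solve 5 (λ e a b c d →
    ((con 1ℚ :- e) :* a :+ e :* b) :- ((con 1ℚ :- e) :* c :+ e :* d)
      := (con 1ℚ :- e) :* (a :- c) :+ e :* (b :- d)) refl

  *-distribˡ-mix : ∀ x e a b → x * mix e a b ≡ mix e (x * a) (x * b)
  *-distribˡ-mix = solve 4 (λ x e a b →
    x :* ((con 1ℚ :- e) :* a :+ e :* b) := (con 1ℚ :- e) :* (x :* a) :+ e :* (x :* b)) refl

  mix-as-affine : ∀ e a b → e * (a - b) + mix e a b ≡ a
  mix-as-affine = solve 3 (λ e a b →
    e :* (a :- b) :+ ((con 1ℚ :- e) :* a :+ e :* b) := a) refl

  mix-nonNeg : ∀ {e a b} → 0ℚ ≤ e → e ≤ 1ℚ → 0ℚ ≤ a → 0ℚ ≤ b → 0ℚ ≤ mix e a b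
  mix-nonNeg {e} {a} {b} 0≤e e≤1 0≤a 0≤b =
    subst (_≤ mix e a b) (+-identityʳ 0ℚ) (+-mono-≤ (0≤* (0≤1-e e≤1) 0≤a) (0≤* 0≤e 0≤b))

  mix-pos : ∀ {e a b} → 0ℚ ≤ e → e < 1ℚ → 0ℚ < a → 0ℚ ≤ b → 0ℚ < mix e a b
  mix-pos {e} {a} {b} 0≤e e<1 0<a 0≤b =
    subst (_< mix e a b) (+-identityʳ 0ℚ) (+-mono-<-≤ (0<* (0<1-e e<1) 0<a) (0≤* 0≤e 0≤b))

p≢q⇒p-q≢0 : ∀ {p q} → p ≢ q → p - q ≢ 0ℚ
p≢q⇒p-q≢0 {p} {q} p≢q = p≢q ∘ x∙y⁻¹≈ε⇒x≈y p q

-- The weight at which mix e a b vanishes; 0 is a junk value for a ≡ b.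
root : ℚ → ℚ → ℚ
root a b with a ≟ b
... | yes _   = 0ℚ
... | no  a≢b = a * (1/ (a - b)) {{≢-nonZero (p≢q⇒p-q≢0 a≢b)}}

mix≡0⇒≡root : ∀ {e a b} → a ≢ 0ℚ ⊎ b ≢ 0ℚ → mix e a b ≡ 0ℚ → e ≡ root a b
mix≡0⇒≡root {e} {a} {b} nonzero mix≡0 with a ≟ b
... | yes refl = contradiction (trans (sym (mix-same e a)) mix≡0) ([ id , id ]′ nonzero)
... | no  a≢b  = begin
  e                  ≡⟨ sym (*-identityʳ e) ⟩
  e * 1ℚ             ≡⟨ cong (e *_) (sym (*-inverseʳ d)) ⟩
  e * (d * 1/ d)     ≡⟨ sym (*-assoc e d (1/ d)) ⟩
  e * d * 1/ d       ≡⟨ cong (_* 1/ d) e*d≡a ⟩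
  a * 1/ d           ∎
  where
  open ≡-Reasoning
  d : ℚ
  d = a - b
  instance
    d-nonZero : NonZero d
    d-nonZero = ≢-nonZero (p≢q⇒p-q≢0 a≢b)
  e*d≡a : e * d ≡ a
  e*d≡a = begin
    e * d              ≡⟨ sym (+-identityʳ (e * d)) ⟩
    e * d + 0ℚ         ≡⟨ cong (e * d +_) (sym mix≡0) ⟩
    e * d + mix e a b  ≡⟨ mix-as-affine e a b ⟩
    a                  ∎

∃-lower-bound-of-positives : (xs : List ℚ) →
  ∃ λ g → 0ℚ < g × g ≤ 1ℚ × All (λ x → x ≤ 0ℚ ⊎ g ≤ x) xs
∃-lower-bound-of-positives [] = 1ℚ , 0<1 , ≤-refl , []
∃-lower-bound-of-positives (x ∷ xs) with ∃-lower-bound-of-positives xs | x ≤? 0ℚ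
... | g , 0<g , g≤1 , gaps | yes x≤0 = g , 0<g , g≤1 , inj₁ x≤0 ∷ gaps
... | g , 0<g , g≤1 , gaps | no  x≰0 =
    g ⊓ x , 0<g⊓x , p≤q⇒p⊓r≤q x g≤1
  , inj₂ (p⊓q≤q g x) ∷ All.map (Sum.map₂ (≤-trans (p⊓q≤p g x))) gaps
  where
  0<g⊓x : 0ℚ < g ⊓ x
  0<g⊓x = [ (λ g⊓x≡g → subst (0ℚ <_) (sym g⊓x≡g) 0<g)
          , (λ g⊓x≡x → subst (0ℚ <_) (sym g⊓x≡x) (≰⇒> x≰0)) ]′ (⊓-sel g x)

∃-unit-interval-avoiding : (xs : List ℚ) → ∃ λ e → 0ℚ < e × e < 1ℚ × All (e ≢_) xs
∃-unit-interval-avoiding xs with ∃-lower-bound-of-positives xs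
... | g , 0<g , g≤1 , gaps = ½ * g , 0<e , <-≤-trans e<g g≤1 , All.map avoids gaps
  where
  e<g : ½ * g < g
  e<g = subst (½ * g <_) (*-identityˡ g)
              (*-monoˡ-<-pos g {{positive 0<g}} (toWitness {a? = ½ <? 1ℚ} tt))
  0<e : 0ℚ < ½ * g
  0<e = 0<* (toWitness {a? = 0ℚ <? ½} tt) 0<g
  avoids : ∀ {x} → x ≤ 0ℚ ⊎ g ≤ x → ½ * g ≢ x
  avoids (inj₁ x≤0) refl = <-irrefl refl (<-≤-trans 0<e x≤0)
  avoids (inj₂ g≤x) refl = <-irrefl refl (<-≤-trans e<g g≤x)

∃-mix-avoiding-zeros : {X : Set} (xs : List X) (a b : X → ℚ) →
  ∃ λ e → 0ℚ < e × e < 1ℚ × All (λ x → a x ≢ 0ℚ ⊎ b x ≢ 0ℚ → mix e (a x) (b x) ≢ 0ℚ) xs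
∃-mix-avoiding-zeros xs a b with ∃-unit-interval-avoiding (map (λ x → root (a x) (b x)) xs)
... | e , 0<e , e<1 , avoids =
  e , 0<e , e<1 , All.map (λ e≢root nonzero → e≢root ∘ mix≡0⇒≡root nonzero) (map⁻ avoids)

sumTo-cong : ∀ N {f g : ℕ → ℚ} → (∀ n → f n ≡ g n) → sumTo N f ≡ sumTo N g
sumTo-cong zero    f≗g = refl
sumTo-cong (suc N) f≗g = cong₂ _+_ (sumTo-cong N f≗g) (f≗g N)

sumTo-mix : ∀ N e (f g : ℕ → ℚ) →
  sumTo N (λ n → mix e (f n) (g n)) ≡ mix e (sumTo N f) (sumTo N g)
sumTo-mix zero    e f g = sym (mix-same e 0ℚ)
sumTo-mix (suc N) e f g =
  trans (cong (_+ mix e (f N) (g N)) (sumTo-mix N e f g)) (mix-+ e _ _ _ _)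

sumTo-zero : ∀ N (f : ℕ → ℚ) → (∀ n → n ℕ.< N → f n ≡ 0ℚ) → sumTo N f ≡ 0ℚ
sumTo-zero zero    f f≡0 = refl
sumTo-zero (suc N) f f≡0 =
  trans (cong₂ _+_ (sumTo-zero N f (λ n n<N → f≡0 n (ℕ.m<n⇒m<1+n n<N))) (f≡0 N ℕ.≤-refl))
        (+-identityʳ 0ℚ)

sumTo-single : ∀ N (f : ℕ → ℚ) {n₀} → n₀ ℕ.< N → (∀ n → n ≢ n₀ → f n ≡ 0ℚ) → sumTo N f ≡ f n₀
sumTo-single (suc N) f {n₀} n₀<1+N f≡0 with n₀ ℕ.≟ N
... | yes refl =
  trans (cong (_+ f N) (sumTo-zero N f (λ n n<N → f≡0 n (ℕ.<⇒≢ n<N)))) (+-identityˡ (f N))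
... | no  n₀≢N =
  trans (cong₂ _+_ (sumTo-single N f (ℕ.≤∧≢⇒< (ℕ.≤-pred n₀<1+N) n₀≢N) f≡0) (f≡0 N (n₀≢N ∘ sym)))
        (+-identityʳ (f n₀))

sumFin-cong : ∀ q {f g : Fin q → ℚ} → (∀ i → f i ≡ g i) → sumFin q f ≡ sumFin q g
sumFin-cong zero    f≗g = refl
sumFin-cong (suc q) f≗g = cong₂ _+_ (f≗g Fin.zero) (sumFin-cong q (f≗g ∘ Fin.suc))

sumFin-mix : ∀ q e (f g : Fin q → ℚ) →
  sumFin q (λ i → mix e (f i) (g i)) ≡ mix e (sumFin q f) (sumFin q g)
sumFin-mix zero    e f g = sym (mix-same e 0ℚ)
sumFin-mix (suc q) e f g =
  trans (cong (mix e (f Fin.zero) (g Fin.zero) +_) (sumFin-mix q e (f ∘ Fin.suc) (g ∘ Fin.suc)))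
        (mix-+ e _ _ _ _)

sumFin-zero : ∀ q (f : Fin q → ℚ) → (∀ i → f i ≡ 0ℚ) → sumFin q f ≡ 0ℚ
sumFin-zero zero    f f≡0 = refl
sumFin-zero (suc q) f f≡0 =
  trans (cong₂ _+_ (f≡0 Fin.zero) (sumFin-zero q _ (f≡0 ∘ Fin.suc))) (+-identityʳ 0ℚ)

sumFin-single : ∀ q (f : Fin q → ℚ) i₀ → (∀ i → i ≢ i₀ → f i ≡ 0ℚ) → sumFin q f ≡ f i₀
sumFin-single (suc q) f Fin.zero f≡0 =
  trans (cong (f Fin.zero +_) (sumFin-zero q _ (λ i → f≡0 (Fin.suc i) (λ ()))))
        (+-identityʳ (f Fin.zero))
sumFin-single (suc q) f (Fin.suc i₀) f≡0 =
  trans (cong₂ _+_ (f≡0 Fin.zero (λ ()))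
                   (sumFin-single q (f ∘ Fin.suc) i₀ (λ i i≢i₀ → f≡0 (Fin.suc i) (i≢i₀ ∘ suc-injective))))
        (+-identityˡ (f (Fin.suc i₀)))

pointMass : ℕ → Vec∞
pointMass n₀ n with n ℕ.≟ n₀
... | yes _ = 1ℚ
... | no  _ = 0ℚ

pointMass-at : ∀ n₀ → pointMass n₀ n₀ ≡ 1ℚ
pointMass-at n₀ with n₀ ℕ.≟ n₀
... | yes _     = refl
... | no  n₀≢n₀ = contradiction refl n₀≢n₀

pointMass-off : ∀ {n₀ n} → n ≢ n₀ → pointMass n₀ n ≡ 0ℚ
pointMass-off {n₀} {n} n≢n₀ with n ℕ.≟ n₀
... | yes n≡n₀ = contradiction n≡n₀ n≢n₀
... | no  _    = refl

pointMass-nonNeg : ∀ n₀ n → 0ℚ ≤ pointMass n₀ n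
pointMass-nonNeg n₀ n with n ℕ.≟ n₀
... | yes _ = <⇒≤ 0<1
... | no  _ = ≤-refl

mix∞ : ℚ → Vec∞ → Vec∞ → Vec∞
mix∞ e v w n = mix e (v n) (w n)

Distribution : ℕ → Vec∞ → Set
Distribution N v = SupportedBelow N v × Stochastic N v

pointMass-distribution : ∀ {N n₀} → n₀ ℕ.< N → Distribution N (pointMass n₀)
pointMass-distribution {N} {n₀} n₀<N =
    (λ n n≥N → pointMass-off {n₀} {n} (λ { refl → ℕ.<⇒≱ n₀<N n≥N }))
  , pointMass-nonNeg n₀
  , trans (sumTo-single N (pointMass n₀) n₀<N (λ n → pointMass-off {n₀} {n})) (pointMass-at n₀)

mix-distribution : ∀ {N e v w} → 0ℚ ≤ e → e ≤ 1ℚ →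
  Distribution N v → Distribution N w → Distribution N (mix∞ e v w)
mix-distribution {N} {e} {v} {w} 0≤e e≤1 (v-supp , v≥0 , Σv≡1) (w-supp , w≥0 , Σw≡1) =
    (λ n n≥N → trans (cong₂ (mix e) (v-supp n n≥N) (w-supp n n≥N)) (mix-same e 0ℚ))
  , (λ n → mix-nonNeg 0≤e e≤1 (v≥0 n) (w≥0 n))
  , (begin
      sumTo N (mix∞ e v w)            ≡⟨ sumTo-mix N e v w ⟩
      mix e (sumTo N v) (sumTo N w)   ≡⟨ cong₂ (mix e) Σv≡1 Σw≡1 ⟩
      mix e 1ℚ 1ℚ                     ≡⟨ mix-same e 1ℚ ⟩
      1ℚ                              ∎)
  where open ≡-Reasoning

ZeroRow : ∀ {p} → Mat∞ p → Fin p → Set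
ZeroRow M j = ∀ n → M j n ≡ 0ℚ

UnitColumnAt : ∀ {p} → Mat∞ p → Fin p → ℕ → Set
UnitColumnAt M j n = ∀ i → M i n ≡ unitVec j i

mulVec∞-mix : ∀ {p} (M : Mat∞ p) N e v w i →
  mulVec∞ M N (mix∞ e v w) i ≡ mix e (mulVec∞ M N v i) (mulVec∞ M N w i)
mulVec∞-mix M N e v w i =
  trans (sumTo-cong N (λ n → *-distribˡ-mix (M i n) e (v n) (w n))) (sumTo-mix N e _ _)

mulVec∞-pointMass : ∀ {p} (M : Mat∞ p) {N n₀} → n₀ ℕ.< N → ∀ i →
  mulVec∞ M N (pointMass n₀) i ≡ M i n₀
mulVec∞-pointMass M {N} {n₀} n₀<N i =
  trans (sumTo-single N _ n₀<N
          (λ n n≢n₀ → trans (cong (M i n *_) (pointMass-off n≢n₀)) (*-zeroʳ (M i n))))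
        (trans (cong (M i n₀ *_) (pointMass-at n₀)) (*-identityʳ (M i n₀)))

mulVec∞-zeroRow : ∀ {p} (M : Mat∞ p) N v {i} → ZeroRow M i → mulVec∞ M N v i ≡ 0ℚ
mulVec∞-zeroRow M N v zero-row =
  sumTo-zero N _ (λ n _ → trans (cong (_* v n) (zero-row n)) (*-zeroˡ (v n)))

mulTie-cong : ∀ {m p} (H : Fin m → Fin p → ℕ) r {u w} →
  (∀ c → u c ≡ w c) → mulTie H u r ≡ mulTie H w r
mulTie-cong {p = p} H r u≗w = sumFin-cong p (cong (ℕ→ℚ (H r _) *_) ∘ u≗w)

mulTie-mix : ∀ {m p} (H : Fin m → Fin p → ℕ) r e u w →
  mulTie H (λ c → mix e (u c) (w c)) r ≡ mix e (mulTie H u r) (mulTie H w r)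
mulTie-mix {p = p} H r e u w =
  trans (sumFin-cong p (λ c → *-distribˡ-mix (ℕ→ℚ (H r c)) e (u c) (w c))) (sumFin-mix p e _ _)

mulTie-unitVec : ∀ {m p} (H : Fin m → Fin p → ℕ) r c → mulTie H (unitVec c) r ≡ ℕ→ℚ (H r c)
mulTie-unitVec {p = p} H r c =
  trans (sumFin-single p _ c
          (λ i i≢c → trans (cong (ℕ→ℚ (H r i) *_) (unitVec-off i≢c)) (*-zeroʳ (ℕ→ℚ (H r i)))))
        (trans (cong (ℕ→ℚ (H r c) *_) (unitVec-at c)) (*-identityʳ (ℕ→ℚ (H r c))))
  where
  unitVec-at : ∀ (c : Fin p) → unitVec c c ≡ 1ℚ
  unitVec-at c with c Fin.≟ c
  ... | yes _   = refl
  ... | no  c≢c = contradiction refl c≢c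
  unitVec-off : ∀ {c i : Fin p} → i ≢ c → unitVec c i ≡ 0ℚ
  unitVec-off {c = c} {i} i≢c with i Fin.≟ c
  ... | yes i≡c = contradiction i≡c i≢c
  ... | no  _   = refl

-- For a zero row the column index is a junk value 0.
skeletalColumn : ∀ {p} {M : Mat∞ p} → Skeletal M → Fin p → ℕ
skeletalColumn skeletal j with skeletal j
... | inj₁ _       = 0
... | inj₂ (n , _) = n

skeletalColumn-spec : ∀ {p} {M : Mat∞ p} (skeletal : Skeletal M) j →
  ZeroRow M j ⊎ UnitColumnAt M j (skeletalColumn skeletal j)
skeletalColumn-spec skeletal j with skeletal j
... | inj₁ zero-row     = inj₁ zero-row
... | inj₂ (_ , unit)   = inj₂ unit

finite-bound : ∀ q (f : Fin q → ℕ) → ∃ λ B → ∀ i → f i ℕ.≤ B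
finite-bound zero    f = 0 , λ ()
finite-bound (suc q) f with finite-bound q (f ∘ Fin.suc)
... | B , f≤B = f Fin.zero ⊔ B , λ where
  Fin.zero    → ℕ.m≤m⊔n (f Fin.zero) B
  (Fin.suc i) → ℕ.m≤n⇒m≤o⊔n (f Fin.zero) (f≤B i)

all-or-witness : ∀ {q} {P Q : Fin q → Set} → (∀ i → P i ⊎ Q i) → (∀ i → P i) ⊎ ∃ Q
all-or-witness {zero}  P⊎Q = inj₁ λ ()
all-or-witness {suc q} P⊎Q with P⊎Q Fin.zero | all-or-witness (P⊎Q ∘ Fin.suc)
... | inj₂ q₀ | _             = inj₂ (Fin.zero , q₀)
... | inj₁ _  | inj₂ witness  = inj₂ (∃-there witness)
... | inj₁ p₀ | inj₁ all      = inj₁ (∀-cons p₀ all)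

module TieBreaking {k p m : ℕ} (M : Fin k → Mat∞ p) (H : Fin m → Fin p → ℕ)
                   (skeletal : ∀ j → Skeletal (M j)) (ties : TieMatrix m p H) where

  column : Fin k → Fin p → ℕ
  column j = skeletalColumn (skeletal j)

  columnBound : ∃ λ B → ∀ j c → column j c ℕ.≤ B
  columnBound with finite-bound k (λ j → proj₁ (finite-bound p (column j)))
  ... | B , rows≤B = B , λ j c → ℕ.≤-trans (proj₂ (finite-bound p (column j)) c) (rows≤B j)

  N : ℕ
  N = 2 ℕ.+ proj₁ columnBound

  column<N : ∀ j c → column j c ℕ.< N
  column<N j c = s≤s (ℕ.m≤n⇒m≤1+n (proj₂ columnBound j c))

  1<N : 1 ℕ.< N
  1<N = s≤s (s≤s ℕ.z≤n)

  out : Fin k → Vec∞ → Fin m → ℚ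
  out j v = mulTie H (mulVec∞ (M j) N v)

  Triple : Set
  Triple = Fin k × Fin m × Fin m

  -- Opaque for the same reason as mix.
  opaque
    gap : Triple → Vec∞ → ℚ
    gap (j , r , r') v = out j v r - out j v r'

    gap-mix : ∀ t e v w → gap t (mix∞ e v w) ≡ mix e (gap t v) (gap t w)
    gap-mix (j , r , r') e v w =
      trans (cong₂ _-_ (out-mix r) (out-mix r'))
            (mix-- e (out j v r) (out j w r) (out j v r') (out j w r'))
      where
      out-mix : ∀ r → out j (mix∞ e v w) r ≡ mix e (out j v r) (out j w r)
      out-mix r = trans (mulTie-cong H r (mulVec∞-mix (M j) N e v w))
                        (mulTie-mix H r e (mulVec∞ (M j) N v) (mulVec∞ (M j) N w))

    gap≡0⇒tie : ∀ {j r r' v} → gap (j , r , r') v ≡ 0ℚ → out j v r ≡ out j v r'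
    gap≡0⇒tie {j} {r} {r'} {v} = x∙y⁻¹≈ε⇒x≈y (out j v r) (out j v r')

    tie⇒gap≡0 : ∀ {j r r' v} → out j v r ≡ out j v r' → gap (j , r , r') v ≡ 0ℚ
    tie⇒gap≡0 {j} {r} {r'} {v} tie = trans (cong (_- out j v r') tie) (+-inverseʳ (out j v r'))

  out-unitColumn : ∀ j c → UnitColumnAt (M j) c (column j c) → ∀ r →
    out j (pointMass (column j c)) r ≡ ℕ→ℚ (H r c)
  out-unitColumn j c unit r =
    trans (mulTie-cong H r (λ i → trans (mulVec∞-pointMass (M j) (column<N j c) i) (unit i)))
          (mulTie-unitVec H r c)

  RowVanishes : Fin k → Fin m → Set
  RowVanishes j r = ∀ v → out j v r ≡ 0ℚ

  vanishes-or-unitColumn : ∀ j r →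
    RowVanishes j r ⊎ ∃ λ c → ℕ→ℚ (H r c) ≢ 0ℚ × UnitColumnAt (M j) c (column j c)
  vanishes-or-unitColumn j r =
    Sum.map₁ (λ terms≡0 v → sumFin-zero p _ (λ c → terms≡0 c v))
             (all-or-witness term≡0-or-unitColumn)
    where
    term≡0-or-unitColumn : ∀ c → (∀ v → ℕ→ℚ (H r c) * mulVec∞ (M j) N v c ≡ 0ℚ)
                               ⊎ (ℕ→ℚ (H r c) ≢ 0ℚ × UnitColumnAt (M j) c (column j c))
    term≡0-or-unitColumn c with skeletalColumn-spec (skeletal j) c | ℕ→ℚ (H r c) ≟ 0ℚ
    ... | inj₁ zero-row | _ = inj₁ λ v →
      trans (cong (ℕ→ℚ (H r c) *_) (mulVec∞-zeroRow (M j) N v zero-row)) (*-zeroʳ (ℕ→ℚ (H r c)))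
    ... | inj₂ _ | yes Hrc≡0 = inj₁ λ v →
      trans (cong (_* mulVec∞ (M j) N v c) Hrc≡0) (*-zeroˡ (mulVec∞ (M j) N v c))
    ... | inj₂ unit | no Hrc≢0 = inj₂ (Hrc≢0 , unit)

  Settled : Vec∞ → Triple → Set
  Settled v (j , r , r') = r ≡ r' ⊎ RowVanishes j r ⊎ gap (j , r , r') v ≢ 0ℚ

  Admissible : Vec∞ → Set
  Admissible v = Distribution N v × 0ℚ < v 1

  settled-mix : ∀ {e v w} t →
    (gap t v ≢ 0ℚ ⊎ gap t w ≢ 0ℚ → mix e (gap t v) (gap t w) ≢ 0ℚ) →
    Settled v t → Settled (mix∞ e v w) t
  settled-mix t keep (inj₁ r≡r')            = inj₁ r≡r'
  settled-mix t keep (inj₂ (inj₁ vanishes)) = inj₂ (inj₁ vanishes)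
  settled-mix {e} {v} {w} t keep (inj₂ (inj₂ gap≢0)) =
    inj₂ (inj₂ (keep (inj₁ gap≢0) ∘ trans (sym (gap-mix t e v w))))

  settle-by-mixing : ∀ {v w} t ts → Admissible v → Distribution N w → gap t w ≢ 0ℚ →
    All (Settled v) ts → ∃ λ v′ → Admissible v′ × All (Settled v′) (t ∷ ts)
  settle-by-mixing {v} {w} t ts (v-dist , v₁>0) w-dist gap≢0 settled
    with ∃-mix-avoiding-zeros (t ∷ ts) (λ t → gap t v) (λ t → gap t w)
  ... | e , 0<e , e<1 , keep ∷ keeps =
      mix∞ e v w
    , ( mix-distribution (<⇒≤ 0<e) (<⇒≤ e<1) v-dist w-dist
      , mix-pos (<⇒≤ 0<e) e<1 v₁>0 (proj₁ (proj₂ w-dist) 1))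
    , inj₂ (inj₂ (keep (inj₂ gap≢0) ∘ trans (sym (gap-mix t e v w))))
    ∷ All.zipWith (λ (keep , settled) → settled-mix {e} {v} {w} _ keep settled) (keeps , settled)

  settle : ∀ t {ts} → (∃ λ v → Admissible v × All (Settled v) ts) →
    ∃ λ v → Admissible v × All (Settled v) (t ∷ ts)
  settle (j , r , r') {ts} (v , admissible , settled) with r Fin.≟ r' | vanishes-or-unitColumn j r
  ... | yes r≡r' | _               = v , admissible , inj₁ r≡r' ∷ settled
  ... | no  _    | inj₁ vanishes   = v , admissible , inj₂ (inj₁ vanishes) ∷ settled
  ... | no  r≢r' | inj₂ (c , Hrc≢0 , unit) =
    settle-by-mixing (j , r , r') ts admissible (pointMass-distribution (column<N j c)) gap≢0 settled
    where
    gap≢0 : gap (j , r , r') (pointMass (column j c)) ≢ 0ℚ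
    gap≢0 gap≡0 = ties c r r' r≢r' Hrc≢0
      (trans (sym (out-unitColumn j c unit r))
             (trans (gap≡0⇒tie gap≡0) (out-unitColumn j c unit r')))

  settle-all : (ts : List Triple) → ∃ λ v → Admissible v × All (Settled v) ts
  settle-all []       =
    pointMass 1 , (pointMass-distribution 1<N , subst (0ℚ <_) (sym (pointMass-at 1)) 0<1) , []
  settle-all (t ∷ ts) = settle t (settle-all ts)

  allTriples : List Triple
  allTriples = cartesianProduct (allFin k) (cartesianProduct (allFin m) (allFin m))

  ∈-allTriples : ∀ t → t ∈ allTriples
  ∈-allTriples (j , r , r') =
    ∈-cartesianProduct⁺ (∈-allFin j) (∈-cartesianProduct⁺ (∈-allFin r) (∈-allFin r'))

  settled⇒tieless : ∀ {v} → (∀ t → Settled v t) → ∀ j → HTieless H (mulVec∞ (M j) N v)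
  settled⇒tieless {v} settled j r r' r≢r' out≢0 out≡ with settled (j , r , r')
  ... | inj₁ r≡r'              = r≢r' r≡r'
  ... | inj₂ (inj₁ vanishes)   = out≢0 (vanishes v)
  ... | inj₂ (inj₂ gap≢0)      = gap≢0 (tie⇒gap≡0 out≡)

lemma5p2 : (k p m : ℕ) (M : Fin k → Mat∞ p) (H : Fin m → Fin p → ℕ) →
    (∀ j → Skeletal (M j)) → TieMatrix m p H →
    Σ Vec∞ λ v → Σ ℕ λ N →
      SupportedBelow N v × Stochastic N v × 0ℚ < v 1 ×
      (∀ (j : Fin k) → HTieless H (mulVec∞ (M j) N v))
lemma5p2 k p m M H skeletal ties =
  let open TieBreaking M H skeletal ties
      (v , ((supported , stochastic) , v₁>0) , settled) = settle-all allTriples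
  in v , N , supported , stochastic , v₁>0 , settled⇒tieless (All.lookup settled ∘ ∈-allTriples)
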